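{- Let $\vec\Gamma$ be a connected locally finite oriented graph, $M\in\{1,2,\dots\}\cup\{\infty\}$ and $v$ a vertex of $\vec\Gamma$. Then the rooted oriented graph $(\vec\Gamma,v)$ is isomorphic (as a rooted oriented graph) to the connected component of $(v,0)$ in $\vec\Gamma\otimes\vec C_M$, rooted at $(v,0)$, if and only if $\mathrm{der}(\vec\Gamma)\equiv0\pmod M$.
   Context: An oriented graph has vertices, edges and maps $\iota,\tau$; loops and multiple edges allowed; locally finite means every vertex has finitely many outgoing and finitely many incoming edges; connectedness is in the non-oriented sense. The tensor product $\vec\Gamma\otimes\vec\Delta$ has vertex set $V(\vec\Gamma)\times V(\vec\Delta)$ and an edge $(e,f)$ from $(v_1,w_1)$ to $(v_2,w_2)$ for each edge $e\colon v_1\to v_2$ of $\vec\Gamma$ and $f\colon w_1\to w_2$ of $\vec\Delta$. $\vec C_M$ has vertex set $\mathbb Z/M\mathbb Z$ ($\mathbb Z$ if $M=\infty$) and one edge $i\to i+1$ for each $i$. A path in the underlying non-oriented graph is a sequence of edges each traversed either forwards or backwards; its derangement $\mathrm{der}(p)$ is the number of forward steps minus the number of backward steps. $\mathrm{der}(\vec\Gamma)$ is the minimum of $|\mathrm{der}(p)|$ over closed paths $p$ with $\mathrm{der}(p)\ne0$, and $0$ if no such path exists. Congruence modulo $\infty$ means equality. -}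

module Defs where

open import Data.Nat using (ℕ; zero; suc; _≤_; NonZero)
open import Data.Nat.DivMod using (_mod_)
open import Data.Nat.Divisibility using (_∣_)
open import Data.Fin using (Fin; toℕ)
open import Data.Integer as ℤ using (ℤ; 0ℤ; ∣_∣)
open import Data.Product using (Σ; _×_; _,_; proj₁; proj₂)
open import Data.Sum using (_⊎_)
open import Relation.Binary.PropositionalEquality using (_≡_; _≢_)
open import Function.Bundles using (_↔_; Inverse)

record OGraph : Set₁ where
  field
    V : Set
    E : Set
    ι : E → V
    τ : E → V
open OGraph public

Finite : Set → Set
Finite A = Σ ℕ λ n → Fin n ↔ A

LocallyFinite : OGraph → Set
LocallyFinite G =
  (v : V G) → Finite (Σ (E G) λ e → ι G e ≡ v) × Finite (Σ (E G) λ e → τ G e ≡ v)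

-- Paths in the underlying non-oriented graph, built by appending steps;
-- each step traverses an edge forwards or backwards.
data Path (G : OGraph) (u : V G) : V G → Set where
  nil : Path G u u
  fwd : {e : E G} → Path G u (ι G e) → Path G u (τ G e)
  bwd : {e : E G} → Path G u (τ G e) → Path G u (ι G e)

der : {G : OGraph} {u w : V G} → Path G u w → ℤ
der nil     = 0ℤ
der (fwd p) = der p ℤ.+ ℤ.1ℤ
der (bwd p) = der p ℤ.- ℤ.1ℤ

Connected : OGraph → Set
Connected G = (u w : V G) → Path G u w

IsDer : OGraph → ℕ → Set
IsDer G d =
  (d ≡ 0 × ((u : V G) (p : Path G u u) → der p ≡ 0ℤ))
  ⊎ ((Σ (V G) λ u → Σ (Path G u u) λ p → der p ≢ 0ℤ × ∣ der p ∣ ≡ d)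
     × ((u : V G) (p : Path G u u) → der p ≢ 0ℤ → d ≤ ∣ der p ∣))

data ℕ∞ : Set where
  fin : (m : ℕ) → .{{_ : NonZero m}} → ℕ∞
  ∞   : ℕ∞

≡0mod : ℕ → ℕ∞ → Set
≡0mod d (fin m) = m ∣ d
≡0mod d ∞       = d ≡ 0

C : ℕ∞ → OGraph
C (fin m) = record { V = Fin m ; E = Fin m ; ι = λ i → i ; τ = λ i → suc (toℕ i) mod m }
C ∞       = record { V = ℤ ; E = ℤ ; ι = λ i → i ; τ = λ i → i ℤ.+ ℤ.1ℤ }

zeroC : (M : ℕ∞) → V (C M)
zeroC (fin m) = 0 mod m
zeroC ∞       = 0ℤ

_⊗_ : OGraph → OGraph → OGraph
G ⊗ H = record
  { V = V G × V H
  ; E = E G × E H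
  ; ι = λ ef → ι G (proj₁ ef) , ι H (proj₂ ef)
  ; τ = λ ef → τ G (proj₁ ef) , τ H (proj₂ ef)
  }

-- Connected component of a vertex r (with reachability as an irrelevant field,
-- so that each vertex/edge occurs once).

record CVertex (G : OGraph) (r : V G) : Set where
  constructor cv
  field
    vtx : V G
    .reach : Path G r vtx

record CEdge (G : OGraph) (r : V G) : Set where
  constructor ce
  field
    edg : E G
    .reach : Path G r (ι G edg)

Component : (G : OGraph) → V G → OGraph
Component G r = record
  { V = CVertex G r
  ; E = CEdge G r
  ; ι = λ { (ce e p) → cv (ι G e) p }
  ; τ = λ { (ce e p) → cv (τ G e) (fwd p) }
  }

componentRoot : (G : OGraph) (r : V G) → V (Component G r)
componentRoot G r = cv r nil

record RootedIso (G : OGraph) (v : V G) (H : OGraph) (w : V H) : Set where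
  field
    φV : V G ↔ V H
    φE : E G ↔ E H
    ι-comm : (e : E G) → ι H (Inverse.to φE e) ≡ Inverse.to φV (ι G e)
    τ-comm : (e : E G) → τ H (Inverse.to φE e) ≡ Inverse.to φV (τ G e)
    root   : Inverse.to φV v ≡ w

-- The projection of G ⊗ C M onto G is a covering, and the component of (v , 0)
-- is a copy of G exactly when the height w ↦ der (path v → w) mod M does not
-- depend on the path, i.e. when every closed path of G has derangement ≡ 0 mod M.
-- Derangements of closed paths at a vertex are closed under concatenation,
-- reversal and conjugation, so by Euclidean division against one of minimal
-- nonzero absolute value they are exactly the multiples of der G.
module Submission where

open import Defs
open import Data.Nat as ℕ using (ℕ; zero; suc; NonZero)
import Data.Nat.Properties as ℕ
import Data.Nat.Divisibility as ℕ
open import Data.Nat.DivMod using (_mod_; m<n⇒m%n≡m)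
open import Data.Fin as Fin using (Fin; toℕ; fromℕ<)
open import Data.Fin.Properties using (toℕ-injective; toℕ-fromℕ<; toℕ<n)
open import Data.Integer as ℤ using (ℤ; +_; -[1+_]; 0ℤ; 1ℤ; _+_; _-_; _*_; -_; ∣_∣; _%ℕ_; _/ℕ_)
import Data.Integer.Properties as ℤ
open import Data.Integer.DivMod using (n%ℕd<d; a≡a%ℕn+[a/ℕn]*n)
open import Data.Integer.Divisibility.Signed
  using (_∣_; divides; ∣-refl; ∣⇒∣ᵤ; ∣ᵤ⇒∣; ∣-trans; ∣m∣n⇒∣m+n; ∣m+n∣n⇒∣m; ∣n⇒∣m*n)
open import Data.Integer.Tactic.RingSolver using (solve-∀)
open import Data.Product using (Σ; _,_; proj₁; proj₂)
open import Data.Sum using (inj₁; inj₂)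
open import Function.Base using (_∘_)
open import Function.Bundles using (_⇔_; mk⇔; Equivalence; Inverse; mk↔ₛ′)
open import Relation.Binary.Definitions using (DecidableEquality)
open import Relation.Binary.PropositionalEquality
open import Relation.Nullary using (contradiction)
open import Relation.Nullary.Decidable using (recompute)

private
  variable
    G H K : OGraph

module _ {G : OGraph} where

  infixl 5 _▷_

  _▷_ : {u w x : V G} → Path G u w → Path G w x → Path G u x
  p ▷ nil   = p
  p ▷ fwd q = fwd (p ▷ q)
  p ▷ bwd q = bwd (p ▷ q)

  der-▷ : {u w x : V G} (p : Path G u w) (q : Path G w x) → der (p ▷ q) ≡ der p + der q
  der-▷ p nil     = sym (ℤ.+-identityʳ (der p))
  der-▷ p (fwd q) = trans (cong (_+ 1ℤ) (der-▷ p q)) (ℤ.+-assoc (der p) (der q) 1ℤ)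
  der-▷ p (bwd q) = trans (cong (_- 1ℤ) (der-▷ p q)) (ℤ.+-assoc (der p) (der q) (- 1ℤ))

  reverse : {u w : V G} → Path G u w → Path G w u
  reverse nil     = nil
  reverse (fwd p) = bwd nil ▷ reverse p
  reverse (bwd p) = fwd nil ▷ reverse p

  der-reverse : {u w : V G} (p : Path G u w) → der (reverse p) ≡ - der p
  der-reverse nil     = refl
  der-reverse (fwd p) = begin
    der (bwd nil ▷ reverse p) ≡⟨ der-▷ (bwd nil) (reverse p) ⟩
    ℤ.-1ℤ + der (reverse p)   ≡⟨ cong (_+_ ℤ.-1ℤ) (der-reverse p) ⟩
    ℤ.-1ℤ + - der p           ≡⟨ ℤ.+-comm ℤ.-1ℤ (- der p) ⟩
    - der p + ℤ.-1ℤ           ≡⟨ ℤ.neg-distrib-+ (der p) 1ℤ ⟨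
    - (der p + 1ℤ)            ∎
    where open ≡-Reasoning
  der-reverse (bwd p) = begin
    der (fwd nil ▷ reverse p) ≡⟨ der-▷ (fwd nil) (reverse p) ⟩
    1ℤ + der (reverse p)      ≡⟨ cong (_+_ 1ℤ) (der-reverse p) ⟩
    1ℤ + - der p              ≡⟨ ℤ.+-comm 1ℤ (- der p) ⟩
    - der p + 1ℤ              ≡⟨ ℤ.neg-distrib-+ (der p) ℤ.-1ℤ ⟨
    - (der p - 1ℤ)            ∎
    where open ≡-Reasoning

  _^_ : {u : V G} → Path G u u → ℕ → Path G u u
  p ^ zero  = nil
  p ^ suc n = p ▷ p ^ n

  der-^ : {u : V G} (p : Path G u u) (n : ℕ) → der (p ^ n) ≡ + n * der p
  der-^ p zero    = refl
  der-^ p (suc n) = begin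
    der (p ▷ p ^ n)       ≡⟨ der-▷ p (p ^ n) ⟩
    der p + der (p ^ n)   ≡⟨ cong (_+_ (der p)) (der-^ p n) ⟩
    der p + + n * der p   ≡⟨ ℤ.suc-* (+ n) (der p) ⟨
    + suc n * der p       ∎
    where open ≡-Reasoning

Loop : (G : OGraph) → V G → ℤ → Set
Loop G u z = Σ (Path G u u) λ p → der p ≡ z

module _ {G : OGraph} {u : V G} where

  loop-▷ : ∀ {a b} → Loop G u a → Loop G u b → Loop G u (a + b)
  loop-▷ (p , refl) (q , refl) = p ▷ q , der-▷ p q

  loop-reverse : ∀ {z} → Loop G u z → Loop G u (- z)
  loop-reverse (p , refl) = reverse p , der-reverse p

  loop-* : ∀ {z} (k : ℤ) → Loop G u z → Loop G u (k * z)
  loop-* (+ n)    (p , refl) = p ^ n , der-^ p n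
  loop-* -[1+ n ] (p , refl) =
    reverse (p ^ suc n) , trans (der-reverse (p ^ suc n))
                                (trans (cong -_ (der-^ p (suc n))) (ℤ.neg-distribˡ-* (+ suc n) (der p)))

  loop-∣∣ : ∀ {z} → Loop G u z → Loop G u (+ ∣ z ∣)
  loop-∣∣ {z} ℓ with ℤ.+∣i∣≡i⊎+∣i∣≡-i z
  ... | inj₁ ∣z∣≡z  = subst (Loop G u) (sym ∣z∣≡z) ℓ
  ... | inj₂ ∣z∣≡-z = subst (Loop G u) (sym ∣z∣≡-z) (loop-reverse ℓ)

loop-transport : ∀ {u w z} → Path G u w → Loop G u z → Loop G w z
loop-transport s (p , refl) = reverse s ▷ p ▷ s , (begin
  der (reverse s ▷ p ▷ s)           ≡⟨ der-▷ (reverse s ▷ p) s ⟩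
  der (reverse s ▷ p) + der s       ≡⟨ cong (_+ der s) (der-▷ (reverse s) p) ⟩
  der (reverse s) + der p + der s   ≡⟨ cong (λ r → r + der p + der s) (der-reverse s) ⟩
  - der s + der p + der s           ≡⟨ cancel (der s) (der p) ⟩
  der p                             ∎)
  where
  open ≡-Reasoning
  cancel : ∀ a b → - a + b + a ≡ b
  cancel = solve-∀

-- Euclidean division by a loop of minimal nonzero derangement d: the remainder is
-- again the derangement of a loop, so it vanishes.
module _ {G : OGraph} {u : V G} (d : ℕ) .{{_ : NonZero d}} (ℓ : Loop G u (+ d))
         (minimal : (p : Path G u u) → der p ≢ 0ℤ → d ℕ.≤ ∣ der p ∣) where

  remainder-loop : (p : Path G u u) → Loop G u (+ (der p %ℕ d))
  remainder-loop p = subst (Loop G u) p▷ℓ⁻ᵏ≡r (loop-▷ (p , refl) (loop-* (- k) ℓ))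
    where
    k = der p /ℕ d
    cancel : ∀ r k d → r + k * d + - k * d ≡ r
    cancel = solve-∀
    p▷ℓ⁻ᵏ≡r : der p + - k * + d ≡ + (der p %ℕ d)
    p▷ℓ⁻ᵏ≡r = trans (cong (λ z → z + - k * + d) (a≡a%ℕn+[a/ℕn]*n (der p) d)) (cancel _ k (+ d))

  loop-below-minimum : ∀ r → r ℕ.< d → Loop G u (+ r) → r ≡ 0
  loop-below-minimum zero    _   _        = refl
  loop-below-minimum (suc r) r<d (p , eq) =
    contradiction (subst (d ℕ.≤_) (cong ∣_∣ eq) (minimal p p≢0)) (ℕ.<⇒≱ r<d)
    where
    p≢0 : der p ≢ 0ℤ
    p≢0 p≡0 = ℕ.1+n≢0 (ℤ.+-injective (trans (sym eq) p≡0))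

  divides-der : (p : Path G u u) → + d ∣ der p
  divides-der p = divides (der p /ℕ d) (begin
    der p                              ≡⟨ a≡a%ℕn+[a/ℕn]*n (der p) d ⟩
    + (der p %ℕ d) + der p /ℕ d * + d  ≡⟨ cong (λ r → + r + der p /ℕ d * + d) remainder≡0 ⟩
    0ℤ + der p /ℕ d * + d              ≡⟨ ℤ.+-identityˡ _ ⟩
    der p /ℕ d * + d                   ∎)
    where
    open ≡-Reasoning
    remainder≡0 : der p %ℕ d ≡ 0
    remainder≡0 = loop-below-minimum (der p %ℕ d) (n%ℕd<d (der p) d) (remainder-loop p)

IsDer-divides-der : ∀ {d} → Connected G → IsDer G d → ∀ {u} (p : Path G u u) → + d ∣ der p
IsDer-divides-der conn (inj₁ (refl , acyclic)) {u} p = subst (+ 0 ∣_) (sym (acyclic u p)) ∣-refl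
IsDer-divides-der conn (inj₂ ((u₀ , q₀ , q₀≢0 , refl) , minimal)) {u} =
  divides-der ∣ der q₀ ∣ {{ℕ.≢-nonZero (q₀≢0 ∘ ℤ.∣i∣≡0⇒i≡0)}}
              (loop-∣∣ (loop-transport (conn u₀ u) (q₀ , refl))) (minimal u)

record Hom (G H : OGraph) : Set where
  field
    vmap   : V G → V H
    emap   : E G → E H
    ι-comm : (e : E G) → ι H (emap e) ≡ vmap (ι G e)
    τ-comm : (e : E G) → τ H (emap e) ≡ vmap (τ G e)
open Hom

fwd-via : {u x y : V G} (e : E G) → ι G e ≡ x → τ G e ≡ y → Path G u x → Path G u y
fwd-via e refl refl p = fwd p

bwd-via : {u x y : V G} (e : E G) → τ G e ≡ x → ι G e ≡ y → Path G u x → Path G u y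
bwd-via e refl refl p = bwd p

der-fwd-via : {u x y : V G} (e : E G) (i : ι G e ≡ x) (t : τ G e ≡ y) (p : Path G u x) →
              der (fwd-via e i t p) ≡ der p + 1ℤ
der-fwd-via e refl refl p = refl

der-bwd-via : {u x y : V G} (e : E G) (t : τ G e ≡ x) (i : ι G e ≡ y) (p : Path G u x) →
              der (bwd-via e t i p) ≡ der p - 1ℤ
der-bwd-via e refl refl p = refl

mapPath : (f : Hom G H) {u w : V G} → Path G u w → Path H (vmap f u) (vmap f w)
mapPath f nil             = nil
mapPath f (fwd {e = e} p) = fwd-via (emap f e) (ι-comm f e) (τ-comm f e) (mapPath f p)
mapPath f (bwd {e = e} p) = bwd-via (emap f e) (τ-comm f e) (ι-comm f e) (mapPath f p)

der-mapPath : (f : Hom G H) {u w : V G} (p : Path G u w) → der (mapPath f p) ≡ der p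
der-mapPath f nil             = refl
der-mapPath f (fwd {e = e} p) =
  trans (der-fwd-via (emap f e) (ι-comm f e) (τ-comm f e) (mapPath f p)) (cong (_+ 1ℤ) (der-mapPath f p))
der-mapPath f (bwd {e = e} p) =
  trans (der-bwd-via (emap f e) (τ-comm f e) (ι-comm f e) (mapPath f p)) (cong (_- 1ℤ) (der-mapPath f p))

_∘ʰ_ : Hom H K → Hom G H → Hom G K
g ∘ʰ f = record
  { vmap   = vmap g ∘ vmap f
  ; emap   = emap g ∘ emap f
  ; ι-comm = λ e → trans (ι-comm g (emap f e)) (cong (vmap g) (ι-comm f e))
  ; τ-comm = λ e → trans (τ-comm g (emap f e)) (cong (vmap g) (τ-comm f e))
  }

proj₁ʰ : Hom (G ⊗ H) G
proj₁ʰ = record { vmap = proj₁ ; emap = proj₁ ; ι-comm = λ _ → refl ; τ-comm = λ _ → refl }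

proj₂ʰ : Hom (G ⊗ H) H
proj₂ʰ = record { vmap = proj₂ ; emap = proj₂ ; ι-comm = λ _ → refl ; τ-comm = λ _ → refl }

inclusionʰ : (r : V G) → Hom (Component G r) G
inclusionʰ r = record { vmap = CVertex.vtx ; emap = CEdge.edg ; ι-comm = λ _ → refl ; τ-comm = λ _ → refl }

RootedIso⇒Hom : {v : V G} {w : V H} → RootedIso G v H w → Hom G H
RootedIso⇒Hom φ = record
  { vmap = Inverse.to (RootedIso.φV φ)
  ; emap = Inverse.to (RootedIso.φE φ)
  ; ι-comm = RootedIso.ι-comm φ
  ; τ-comm = RootedIso.τ-comm φ
  }

-- C M as the quotient of the oriented line by M ℤ, with quotient map ⟦_⟧

≡0modℤ : ℤ → ℕ∞ → Set
≡0modℤ z (fin m) = + m ∣ z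
≡0modℤ z ∞       = z ≡ 0ℤ

record CycleCoordinates (M : ℕ∞) : Set where
  field
    out           : V (C M) → E (C M)
    ι-out         : (x : V (C M)) → ι (C M) (out x) ≡ x
    out-ι         : (c : E (C M)) → out (ι (C M) c) ≡ c
    ⟦_⟧           : ℤ → V (C M)
    ⟦0⟧           : ⟦ 0ℤ ⟧ ≡ zeroC M
    τ-out-⟦⟧      : (z : ℤ) → τ (C M) (out ⟦ z ⟧) ≡ ⟦ z + 1ℤ ⟧
    ⟦⟧-≡⇒≡0modℤ   : (a b : ℤ) → ⟦ a ⟧ ≡ ⟦ b ⟧ → ≡0modℤ (a - b) M
    ≡0modℤ⇒⟦⟧-≡   : (a b : ℤ) → ≡0modℤ (a - b) M → ⟦ a ⟧ ≡ ⟦ b ⟧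
    ⟦⟧-surjective : (x : V (C M)) → Σ ℤ λ z → ⟦ z ⟧ ≡ x
    _≟_           : DecidableEquality (V (C M))

∣∧<⇒≡0 : ∀ {m n} → m ℕ.∣ n → n ℕ.< m → n ≡ 0
∣∧<⇒≡0 {n = zero}  _   _   = refl
∣∧<⇒≡0 {n = suc n} m∣n n<m = contradiction m∣n (ℕ.>⇒∤ n<m)

module FinCycle (m : ℕ) .{{_ : NonZero m}} where

  ⟦_⟧ : ℤ → Fin m
  ⟦ z ⟧ = fromℕ< (n%ℕd<d z m)

  residue-unique : ∀ {a b} → a ℕ.< m → b ℕ.< m → + m ∣ + a - + b → a ≡ b
  residue-unique {a} {b} a<m b<m m∣a-b =
    ℤ.+-injective (ℤ.i-j≡0⇒i≡j (+ a) (+ b) (ℤ.∣i∣≡0⇒i≡0 (∣∧<⇒≡0 (∣⇒∣ᵤ m∣a-b) ∣a-b∣<m)))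
    where
    ∣a-b∣<m : ∣ + a - + b ∣ ℕ.< m
    ∣a-b∣<m = ℕ.≤-<-trans (subst (ℕ._≤ a ℕ.⊔ b) (cong ∣_∣ (sym (ℤ.m-n≡m⊖n a b))) (ℤ.∣m⊝n∣≤m⊔n a b))
                          (ℕ.⊔-lub a<m b<m)

  difference-of-residues : ∀ a b → a - b ≡ (+ (a %ℕ m) - + (b %ℕ m)) + (a /ℕ m - b /ℕ m) * + m
  difference-of-residues a b =
    trans (cong₂ _-_ (a≡a%ℕn+[a/ℕn]*n a m) (a≡a%ℕn+[a/ℕn]*n b m))
          (regroup (+ (a %ℕ m)) (+ (b %ℕ m)) (a /ℕ m) (b /ℕ m) (+ m))
    where
    regroup : ∀ r s q t n → (r + q * n) - (s + t * n) ≡ (r - s) + (q - t) * n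
    regroup = solve-∀

  ∣-difference⇔∣-residues : ∀ a b → (+ m ∣ a - b) ⇔ (+ m ∣ + (a %ℕ m) - + (b %ℕ m))
  ∣-difference⇔∣-residues a b = mk⇔
    (λ m∣a-b → ∣m+n∣n⇒∣m (subst (+ m ∣_) (difference-of-residues a b) m∣a-b) m∣k*m)
    (λ m∣r-s → subst (+ m ∣_) (sym (difference-of-residues a b)) (∣m∣n⇒∣m+n m∣r-s m∣k*m))
    where
    m∣k*m : + m ∣ (a /ℕ m - b /ℕ m) * + m
    m∣k*m = ∣n⇒∣m*n (a /ℕ m - b /ℕ m) ∣-refl

  ⟦⟧-≡⇒∣ : ∀ a b → ⟦ a ⟧ ≡ ⟦ b ⟧ → + m ∣ a - b
  ⟦⟧-≡⇒∣ a b eq = Equivalence.from (∣-difference⇔∣-residues a b)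
    (subst (+ m ∣_) (sym (ℤ.i≡j⇒i-j≡0 (cong +_ residues-≡))) (divides 0ℤ refl))
    where
    residues-≡ : a %ℕ m ≡ b %ℕ m
    residues-≡ = trans (sym (toℕ-fromℕ< _)) (trans (cong toℕ eq) (toℕ-fromℕ< _))

  ∣⇒⟦⟧-≡ : ∀ a b → + m ∣ a - b → ⟦ a ⟧ ≡ ⟦ b ⟧
  ∣⇒⟦⟧-≡ a b m∣a-b = toℕ-injective (trans (toℕ-fromℕ< _) (trans residues-≡ (sym (toℕ-fromℕ< _))))
    where
    residues-≡ : a %ℕ m ≡ b %ℕ m
    residues-≡ = residue-unique (n%ℕd<d a m) (n%ℕd<d b m) (Equivalence.to (∣-difference⇔∣-residues a b) m∣a-b)

  ⟦+toℕ⟧ : (x : Fin m) → ⟦ + toℕ x ⟧ ≡ x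
  ⟦+toℕ⟧ x = toℕ-injective (trans (toℕ-fromℕ< _) (m<n⇒m%n≡m (toℕ<n x)))

  mod≡⟦+⟧ : (n : ℕ) → n mod m ≡ ⟦ + n ⟧
  mod≡⟦+⟧ n = toℕ-injective (trans (toℕ-fromℕ< _) (sym (toℕ-fromℕ< _)))

  τ-⟦⟧ : (z : ℤ) → suc (toℕ ⟦ z ⟧) mod m ≡ ⟦ z + 1ℤ ⟧
  τ-⟦⟧ z = trans (mod≡⟦+⟧ (suc r))
    (∣⇒⟦⟧-≡ (1ℤ + + r) (z + 1ℤ) (subst (+ m ∣_) (shift (+ r) z) (⟦⟧-≡⇒∣ (+ r) z (⟦+toℕ⟧ ⟦ z ⟧))))
    where
    r = toℕ ⟦ z ⟧
    shift : ∀ a b → a - b ≡ (1ℤ + a) - (b + 1ℤ)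
    shift = solve-∀

finCoordinates : (m : ℕ) .{{_ : NonZero m}} → CycleCoordinates (fin m)
finCoordinates m = record
  { out           = λ x → x
  ; ι-out         = λ _ → refl
  ; out-ι         = λ _ → refl
  ; ⟦_⟧           = ⟦_⟧
  ; ⟦0⟧           = sym (mod≡⟦+⟧ 0)
  ; τ-out-⟦⟧      = τ-⟦⟧
  ; ⟦⟧-≡⇒≡0modℤ   = ⟦⟧-≡⇒∣
  ; ≡0modℤ⇒⟦⟧-≡   = ∣⇒⟦⟧-≡
  ; ⟦⟧-surjective = λ x → + toℕ x , ⟦+toℕ⟧ x
  ; _≟_           = Fin._≟_
  }
  where open FinCycle m

coordinates : (M : ℕ∞) → CycleCoordinates M
coordinates (fin m) = finCoordinates m
coordinates ∞ = record
  { out           = λ x → x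
  ; ι-out         = λ _ → refl
  ; out-ι         = λ _ → refl
  ; ⟦_⟧           = λ z → z
  ; ⟦0⟧           = refl
  ; τ-out-⟦⟧      = λ _ → refl
  ; ⟦⟧-≡⇒≡0modℤ   = λ _ _ → ℤ.i≡j⇒i-j≡0
  ; ≡0modℤ⇒⟦⟧-≡   = ℤ.i-j≡0⇒i≡j
  ; ⟦⟧-surjective = λ x → x , refl
  ; _≟_           = ℤ._≟_
  }

module _ (M : ℕ∞) where
  open CycleCoordinates (coordinates M)

  ι-⟦⟧ : (c : E (C M)) (z : ℤ) → τ (C M) c ≡ ⟦ z ⟧ → ι (C M) c ≡ ⟦ z - 1ℤ ⟧
  ι-⟦⟧ c z τc≡⟦z⟧ = trans (sym ⟦y⟧≡ιc)
    (≡0modℤ⇒⟦⟧-≡ y (z - 1ℤ) (subst (λ w → ≡0modℤ w M) (shift y z) (⟦⟧-≡⇒≡0modℤ (y + 1ℤ) z ⟦y+1⟧≡⟦z⟧)))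
    where
    y = proj₁ (⟦⟧-surjective (ι (C M) c))
    ⟦y⟧≡ιc = proj₂ (⟦⟧-surjective (ι (C M) c))
    ⟦y+1⟧≡⟦z⟧ : ⟦ y + 1ℤ ⟧ ≡ ⟦ z ⟧
    ⟦y+1⟧≡⟦z⟧ = begin
      ⟦ y + 1ℤ ⟧                ≡⟨ τ-out-⟦⟧ y ⟨
      τ (C M) (out ⟦ y ⟧)       ≡⟨ cong (τ (C M) ∘ out) ⟦y⟧≡ιc ⟩
      τ (C M) (out (ι (C M) c)) ≡⟨ cong (τ (C M)) (out-ι c) ⟩
      τ (C M) c                 ≡⟨ τc≡⟦z⟧ ⟩
      ⟦ z ⟧                     ∎
      where open ≡-Reasoning
    shift : ∀ a b → (a + 1ℤ) - b ≡ a - (b - 1ℤ)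
    shift = solve-∀

  ⟦⟧-along : {x y : V (C M)} (P : Path (C M) x y) {z : ℤ} → ⟦ z ⟧ ≡ x → ⟦ z + der P ⟧ ≡ y
  ⟦⟧-along nil             {z} ⟦z⟧≡x = trans (cong ⟦_⟧ (ℤ.+-identityʳ z)) ⟦z⟧≡x
  ⟦⟧-along (fwd {e = c} P) {z} ⟦z⟧≡x = begin
    ⟦ z + (der P + 1ℤ) ⟧            ≡⟨ cong ⟦_⟧ (ℤ.+-assoc z (der P) 1ℤ) ⟨
    ⟦ z + der P + 1ℤ ⟧              ≡⟨ τ-out-⟦⟧ (z + der P) ⟨
    τ (C M) (out ⟦ z + der P ⟧)     ≡⟨ cong (τ (C M) ∘ out) (⟦⟧-along P ⟦z⟧≡x) ⟩
    τ (C M) (out (ι (C M) c))       ≡⟨ cong (τ (C M)) (out-ι c) ⟩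
    τ (C M) c                       ∎
    where open ≡-Reasoning
  ⟦⟧-along (bwd {e = c} P) {z} ⟦z⟧≡x =
    trans (cong ⟦_⟧ (sym (ℤ.+-assoc z (der P) (- 1ℤ)))) (sym (ι-⟦⟧ c (z + der P) (sym (⟦⟧-along P ⟦z⟧≡x))))

  der-loop-C-≡0modℤ : {x : V (C M)} (P : Path (C M) x x) → ≡0modℤ (der P) M
  der-loop-C-≡0modℤ {x} P =
    subst (λ w → ≡0modℤ w M) (cancel z (der P))
          (⟦⟧-≡⇒≡0modℤ (z + der P) z (trans (⟦⟧-along P ⟦z⟧≡x) (sym ⟦z⟧≡x)))
    where
    z = proj₁ (⟦⟧-surjective x)
    ⟦z⟧≡x = proj₂ (⟦⟧-surjective x)
    cancel : ∀ a b → (a + b) - a ≡ b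
    cancel = solve-∀

  der-loop-≡0modℤ : Hom G (C M) → {u : V G} (p : Path G u u) → ≡0modℤ (der p) M
  der-loop-≡0modℤ f p = subst (λ w → ≡0modℤ w M) (der-mapPath f p) (der-loop-C-≡0modℤ (mapPath f p))

module _ (G : OGraph) (M : ℕ∞) (v : V G) where
  open CycleCoordinates (coordinates M)

  private
    G⊗CM : OGraph
    G⊗CM = G ⊗ C M

    root : V G⊗CM
    root = v , zeroC M

  lift : {w : V G} (p : Path G v w) → Path G⊗CM root (w , ⟦ der p ⟧)
  lift nil             = subst (Path G⊗CM root) (cong (v ,_) (sym ⟦0⟧)) nil
  lift (fwd {e = e} p) =
    fwd-via (e , out ⟦ der p ⟧) (cong (ι G e ,_) (ι-out _)) (cong (τ G e ,_) (τ-out-⟦⟧ _)) (lift p)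
  lift (bwd {e = e} p) =
    bwd-via (e , out ⟦ der p - 1ℤ ⟧) (cong (τ G e ,_) (trans (τ-out-⟦⟧ _) (cong ⟦_⟧ (i-1+1≡i (der p)))))
            (cong (ι G e ,_) (ι-out _)) (lift p)
    where
    i-1+1≡i : ∀ i → i - 1ℤ + 1ℤ ≡ i
    i-1+1≡i = solve-∀

  ⟦der⟧-component : {w : V G} {c : V (C M)} (P : Path G⊗CM root (w , c)) → ⟦ der (mapPath proj₁ʰ P) ⟧ ≡ c
  ⟦der⟧-component {c = c} P = begin
    ⟦ der (mapPath proj₁ʰ P) ⟧        ≡⟨ cong ⟦_⟧ (der-mapPath proj₁ʰ P) ⟩
    ⟦ der P ⟧                         ≡⟨ cong ⟦_⟧ (trans (ℤ.+-identityˡ _) (der-mapPath proj₂ʰ P)) ⟨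
    ⟦ 0ℤ + der (mapPath proj₂ʰ P) ⟧   ≡⟨ ⟦⟧-along M (mapPath proj₂ʰ P) ⟦0⟧ ⟩
    c                                 ∎
    where open ≡-Reasoning

  module _ (conn : Connected G) (loops≡0 : {u : V G} (p : Path G u u) → ≡0modℤ (der p) M) where

    height : V G → V (C M)
    height w = ⟦ der (conn v w) ⟧

    ⟦der⟧≡height : {w : V G} (p : Path G v w) → ⟦ der p ⟧ ≡ height w
    ⟦der⟧≡height {w} p =
      ≡0modℤ⇒⟦⟧-≡ (der p) (der q) (subst (λ z → ≡0modℤ z M) der-p▷q⁻¹ (loops≡0 (p ▷ reverse q)))
      where
      q = conn v w
      der-p▷q⁻¹ : der (p ▷ reverse q) ≡ der p - der q
      der-p▷q⁻¹ = trans (der-▷ p (reverse q)) (cong (_+_ (der p)) (der-reverse q))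

    -- Reachability in a component is irrelevant, so the height is recovered
    -- from it through decidable equality of V (C M).
    component-height : {w : V G} {c : V (C M)} → .(Path G⊗CM root (w , c)) → c ≡ height w
    component-height {w} {c} P =
      recompute (c ≟ height w) (trans (sym (⟦der⟧-component P)) (⟦der⟧≡height (mapPath proj₁ʰ P)))

    cv-≡ : {x y : V G⊗CM} .{p : Path G⊗CM root x} .{q : Path G⊗CM root y} → x ≡ y → cv x p ≡ cv y q
    cv-≡ refl = refl

    ce-≡ : {e f : E G⊗CM} .{p : Path G⊗CM root (ι G⊗CM e)} .{q : Path G⊗CM root (ι G⊗CM f)} →
           e ≡ f → ce e p ≡ ce f q
    ce-≡ refl = refl

    vertex-section : V G → CVertex G⊗CM root
    vertex-section w = cv (w , height w) (lift (conn v w))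

    edge-section : E G → CEdge G⊗CM root
    edge-section e =
      ce (e , out (height (ι G e)))
         (subst (Path G⊗CM root) (cong (ι G e ,_) (sym (ι-out _))) (lift (conn v (ι G e))))

    component≅ : RootedIso G v (Component G⊗CM root) (componentRoot G⊗CM root)
    component≅ = record
      { φV     = mk↔ₛ′ vertex-section (proj₁ ∘ CVertex.vtx)
                   (λ { (cv (w , c) P) → cv-≡ (cong (w ,_) (sym (component-height P))) })
                   (λ _ → refl)
      ; φE     = mk↔ₛ′ edge-section (proj₁ ∘ CEdge.edg)
                   (λ { (ce (e , c) P) →
                        ce-≡ (cong (e ,_) (trans (cong out (sym (component-height P))) (out-ι c))) })
                   (λ _ → refl)
      ; ι-comm = λ e → cv-≡ (cong (ι G e ,_) (ι-out _))
      ; τ-comm = λ e → cv-≡ (cong (τ G e ,_) (trans (τ-out-⟦⟧ _) (⟦der⟧≡height (fwd (conn v (ι G e))))))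
      ; root   = cv-≡ (cong (v ,_) (trans (sym (⟦der⟧≡height nil)) ⟦0⟧))
      }

≡0mod⇒≡0modℤ : ∀ {d} (M : ℕ∞) → ≡0mod d M → {z : ℤ} → + d ∣ z → ≡0modℤ z M
≡0mod⇒≡0modℤ (fin m) m∣d d∣z            = ∣-trans (∣ᵤ⇒∣ m∣d) d∣z
≡0mod⇒≡0modℤ ∞       refl (divides q refl) = ℤ.*-zeroʳ q

≡0modℤ⇒≡0mod : (M : ℕ∞) {z : ℤ} → z ≢ 0ℤ → ≡0modℤ z M → ≡0mod ∣ z ∣ M
≡0modℤ⇒≡0mod (fin m) _   m∣z = ∣⇒∣ᵤ m∣z
≡0modℤ⇒≡0mod ∞       z≢0 z≡0 = contradiction z≡0 z≢0

IsDer⇒≡0mod : ∀ {d} (M : ℕ∞) → IsDer G d → ({u : V G} (p : Path G u u) → ≡0modℤ (der p) M) → ≡0mod d M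
IsDer⇒≡0mod (fin m) (inj₁ (refl , _)) _ = m ℕ.∣0
IsDer⇒≡0mod ∞       (inj₁ (refl , _)) _ = refl
IsDer⇒≡0mod M (inj₂ ((_ , p , p≢0 , refl) , _)) loops≡0 = ≡0modℤ⇒≡0mod M p≢0 (loops≡0 p)

theorem3p8 : (G : OGraph) → Connected G → LocallyFinite G →
    (M : ℕ∞) (v : V G) (d : ℕ) → IsDer G d →
    (RootedIso G v (Component (G ⊗ C M) (v , zeroC M)) (componentRoot (G ⊗ C M) (v , zeroC M))
      ⇔ ≡0mod d M)
theorem3p8 G conn _ M v d isDer = mk⇔
  (λ φ → IsDer⇒≡0mod M isDer (der-loop-≡0modℤ M (proj₂ʰ ∘ʰ (inclusionʰ _ ∘ʰ RootedIso⇒Hom φ))))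
  (λ d≡0 → component≅ G M v conn (λ p → ≡0mod⇒≡0modℤ M d≡0 (IsDer-divides-der conn isDer p)))
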